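{- For all integers $3\le a_1\le a_2\le a_3$, the sequence $(K_{a_1},K_{a_2},K_{a_3})$ is nice. In particular, $r^*(K_{a_1},K_{a_2},K_{a_3})=R(a_2,a_3)-1$.
   Context: $R(a,b)$ is the classical two-colour Ramsey number. A colouring $\xi:\binom{[r]}{\le 2}\to[k]$ (on subsets of $[r]$ of size at most 2) is feasible with respect to $(H_1,\ldots,H_k)$ if (P1) for each $i\in[k]$ there is no homomorphism from $H_i$ to the graph on $[r]$ formed by the pairs of $\xi$-colour $i$ (for cliques $H_i=K_{a}$ this means no colour-$i$ copy of $K_a$), and (P2) $\xi(\{x,y\})\ne\xi(\{x\})$ for all distinct $x,y\in[r]$. $r^*(H_1,\ldots,H_k)$ is the largest $r$ admitting a feasible colouring, and $(H_1,\ldots,H_k)$ is nice if every feasible colouring of $\binom{[r^*]}{\le 2}$ assigns the same colour to all singletons. -}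

module Defs where

open import Data.Nat using (ℕ; _<_; _∸_)
open import Data.Fin using (Fin)
open import Data.Vec using (Vec; lookup)
open import Data.Product using (Σ; _×_; ∃)
open import Relation.Nullary using (¬_)
open import Relation.Binary.PropositionalEquality using (_≡_; _≢_)
open import Function.Definitions using (Injective)

-- A colouring ξ of the subsets of [r] of size ≤ 2 with colours in [k]:
-- `pair x y` is the colour of the 2-set {x,y} (symmetric; the diagonal
-- values pair x x are meaningless and never used), `single x` the colour of {x}.
-- (The empty set is irrelevant for (P1),(P2) and is omitted.)
record Colouring (k r : ℕ) : Set where
  field
    pair   : Fin r → Fin r → Fin k
    sym    : ∀ x y → pair x y ≡ pair y x
    single : Fin r → Fin k
open Colouring public

MonoClique : ∀ {k r} → (Fin r → Fin r → Fin k) → Fin k → ℕ → Set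
MonoClique {k} {r} c i a =
  Σ (Fin a → Fin r) λ f → Injective _≡_ _≡_ f ×
    (∀ p q → p ≢ q → c (f p) (f q) ≡ i)

Feasible : ∀ {k r} → Vec ℕ k → Colouring k r → Set
Feasible {k} {r} as ξ =
  (∀ (i : Fin k) → ¬ MonoClique (pair ξ) i (lookup as i))
  × (∀ (x y : Fin r) → x ≢ y → pair ξ x y ≢ single ξ x)

HasFeasible : ∀ {k} → Vec ℕ k → ℕ → Set
HasFeasible {k} as r = Σ (Colouring k r) λ ξ → Feasible as ξ

IsRStar : ∀ {k} → Vec ℕ k → ℕ → Set
IsRStar as r = HasFeasible as r × (∀ s → r < s → ¬ HasFeasible as s)

Nice : ∀ {k} → Vec ℕ k → Set
Nice {k} as = ∀ r → IsRStar as r →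
  (ξ : Colouring k r) → Feasible as ξ → ∀ x y → single ξ x ≡ single ξ y

Arrows : ℕ → ℕ → ℕ → Set
Arrows n a b = (c : Fin n → Fin n → Fin 2) → (∀ x y → c x y ≡ c y x) →
  MonoClique c Fin.zero a Data.Sum.⊎ MonoClique c (Fin.suc Fin.zero) b
  where import Data.Sum
        import Data.Fin as Fin

IsRamsey : ℕ → ℕ → ℕ → Set
IsRamsey a b n = Arrows n a b × (∀ m → m < n → ¬ Arrows m a b)

-- Call the singleton colour of a vertex its class. A feasible colouring ξ of [r] collapses, for
-- each u ∈ {0,1}, to a red/blue colouring χ_u of the pairs: xy is blue iff ξ(xy) = 2, except that
-- inside class 2 it is blue iff ξ(xy) = u. As ξ(xy) differs from the classes of x and y, a blue
-- clique of χ_u is a ξ-clique of colour 2 or u, and a red clique avoids class 0 or class 1, its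
-- parts in each class again being ξ-cliques of colour 0 or 1. A red K_{a₂} of χ_0 must avoid
-- class 0; exchanging class parts between it and a red clique of χ_1 produces ξ-cliques of
-- colours 0 and 1 which bound the latter by a₂. So some χ_u witnesses r < R(a₂,a₃), while a
-- red/blue colouring of K_{R(a₂,a₃)-1} shifted to colours 1/2 with all singletons 0 is feasible.
-- If the singletons of a feasible ξ on [r*] take two values, χ_u has a monochromatic cut between
-- classes; a new vertex that copies an endpoint of one cut edge on each side extends χ_u to
-- K_{r*+1} without larger cliques, contradicting the maximality of r*.
module Submission where

open import Defs
open import Data.Nat using (ℕ; _≤_; _∸_)
open import Data.Vec using (_∷_; [])
open import Data.Product using (_×_)

open import Data.Nat using (zero; suc; _+_; _<_; z≤n; s≤s)
import Data.Nat.Properties as ℕ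
open import Data.Fin as F using (Fin; _≟_)
import Data.Fin.Properties as F
open import Data.Fin.Patterns using (0F; 1F; 2F)
open import Data.Vec as Vec using (Vec)
open import Data.Vec.Properties using (lookup∘tabulate)
open import Data.List using (List; []; _∷_; length; map; filter; tabulate; lookup; _++_)
open import Data.List.Properties using (length-map; length-++; length-tabulate)
open import Data.List.Membership.Propositional using (_∈_; _∉_; find)
open import Data.List.Membership.Propositional.Properties
  using (∈-map⁻; ∈-filter⁻; ∈-++⁻; ∈-tabulate⁻; ∈-lookup)
import Data.List.Membership.DecPropositional as DecMembership
open import Data.List.Relation.Unary.All as All using (All; []; _∷_)
open import Data.List.Relation.Unary.All.Properties using (¬Any⇒All¬)
open import Data.List.Relation.Unary.Any using (here; there; any?)
open import Data.List.Relation.Unary.AllPairs using (AllPairs; []; _∷_)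
import Data.List.Relation.Unary.AllPairs.Properties as AllPairs
open import Data.List.Relation.Unary.Unique.Propositional using (Unique)
import Data.List.Relation.Unary.Unique.Propositional.Properties as Unique
open import Data.Product as Prod using (Σ; ∃; _,_; proj₁; proj₂)
open import Data.Sum as Sum using (_⊎_; inj₁; inj₂)
open import Data.Empty using (⊥; ⊥-elim)
open import Function using (_∘_; case_of_)
open import Function.Definitions using (Injective)
open import Relation.Nullary using (¬_; Dec; yes; no)
open import Relation.Nullary.Decidable
  using (map′; from-yes; decidable-stable; _×-dec_; _⊎-dec_; _→-dec_; ¬?)
open import Relation.Unary using (Decidable; ∁)
open import Relation.Unary.Properties using (∁?)
open import Relation.Binary.PropositionalEquality
  using (_≡_; _≢_; refl; trans; cong; cong₂; subst; subst₂)
import Relation.Binary.PropositionalEquality as ≡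

pattern red  = 0F
pattern blue = 1F

-- Cliques as duplicate-free lists

module _ {A : Set} where

  allPairs-∈ : ∀ {R : A → A → Set} {xs} → Unique xs →
    (∀ {x y} → x ∈ xs → y ∈ xs → x ≢ y → R x y) → AllPairs R xs
  allPairs-∈ []           R = []
  allPairs-∈ (x∉xs ∷ xs!) R =
    All.tabulate (λ y∈ → R (here refl) (there y∈) (All.lookup x∉xs y∈)) ∷
    allPairs-∈ xs! (λ x∈ y∈ → R (there x∈) (there y∈))

  length-filter+∁ : ∀ {P : A → Set} (P? : Decidable P) xs →
    length (filter P? xs) + length (filter (∁? P?) xs) ≡ length xs
  length-filter+∁ P? []       = refl
  length-filter+∁ P? (x ∷ xs) with P? x
  ... | yes _ = cong suc (length-filter+∁ P? xs)
  ... | no _  = trans (ℕ.+-suc _ _) (cong suc (length-filter+∁ P? xs))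

  avoids-one : ∀ {P Q : A → Set} {xs} → Decidable P →
    (∀ {x y} → x ∈ xs → y ∈ xs → P x → Q y → ⊥) → All (∁ P) xs ⊎ All (∁ Q) xs
  avoids-one {xs = xs} P? noPQ with any? P? xs
  ... | no ¬P  = inj₁ (¬Any⇒All¬ xs ¬P)
  ... | yes ∃P = let _ , x∈ , Px = find ∃P in inj₂ (All.tabulate λ y∈ Qy → noPQ x∈ y∈ Px Qy)

  lookup-injective : ∀ {xs : List A} → Unique xs → ∀ {i j} → lookup xs i ≡ lookup xs j → i ≡ j
  lookup-injective (_ ∷ _)    {0F}      {0F}      _  = refl
  lookup-injective (x∉xs ∷ _) {0F}      {F.suc j} eq = ⊥-elim (All.lookup x∉xs (∈-lookup j) eq)
  lookup-injective (x∉xs ∷ _) {F.suc i} {0F}      eq = ⊥-elim (All.lookup x∉xs (∈-lookup i) (≡.sym eq))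
  lookup-injective (_ ∷ xs!)  {F.suc i} {F.suc j} eq = cong F.suc (lookup-injective xs! eq)

  unique-length≤1 : ∀ {a : A} {xs} → Unique xs → All (_≡ a) xs → length xs ≤ 1
  unique-length≤1 []              []                = z≤n
  unique-length≤1 (_ ∷ [])        _                 = s≤s z≤n
  unique-length≤1 ((x≢y ∷ _) ∷ _) (refl ∷ refl ∷ _) = ⊥-elim (x≢y refl)

  unique-length≤2 : ∀ {a b : A} {xs} → Unique xs → All (λ x → x ≡ a ⊎ x ≡ b) xs → length xs ≤ 2
  unique-length≤2 []         []                = z≤n
  unique-length≤2 (x∉ ∷ xs!) (inj₁ refl ∷ xs∈) =
    s≤s (unique-length≤1 xs! (All.zipWith (λ (x≢y , y∈) → Sum.[ ⊥-elim ∘ x≢y ∘ ≡.sym , (λ y≡b → y≡b) ] y∈) (x∉ , xs∈)))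
  unique-length≤2 (x∉ ∷ xs!) (inj₂ refl ∷ xs∈) =
    s≤s (unique-length≤1 xs! (All.zipWith (λ (x≢y , y∈) → Sum.[ (λ y≡a → y≡a) , ⊥-elim ∘ x≢y ∘ ≡.sym ] y∈) (x∉ , xs∈)))

module _ {V C : Set} where

  record IsClique (c : V → V → C) (κ : C) (xs : List V) : Set where
    field
      unique : Unique xs
      edge   : ∀ {x y} → x ∈ xs → y ∈ xs → x ≢ y → c x y ≡ κ

  CliqueFree : (V → V → C) → C → ℕ → Set
  CliqueFree c κ n = ∀ {xs} → IsClique c κ xs → length xs < n

open IsClique public

module _ {V C : Set} {c : V → V → C} {κ : C} where

  clique-filter⁺ : ∀ {P : V → Set} (P? : Decidable P) {xs} → IsClique c κ xs →
    IsClique c κ (filter P? xs)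
  clique-filter⁺ P? K = record
    { unique = Unique.filter⁺ P? (unique K)
    ; edge   = λ x∈ y∈ → edge K (proj₁ (∈-filter⁻ P? x∈)) (proj₁ (∈-filter⁻ P? y∈))
    }

  clique-++⁺ : (∀ x y → c x y ≡ c y x) → ∀ {xs ys} → IsClique c κ xs → IsClique c κ ys →
    (∀ {x y} → x ∈ xs → y ∈ ys → x ≢ y × c x y ≡ κ) → IsClique c κ (xs ++ ys)
  clique-++⁺ c-sym {xs} K L cross = record
    { unique = Unique.++⁺ (unique K) (unique L) (λ (x∈ , x∈′) → proj₁ (cross x∈ x∈′) refl)
    ; edge   = edge′
    }
    where
    edge′ : ∀ {x y} → x ∈ xs ++ _ → y ∈ xs ++ _ → x ≢ y → c x y ≡ κ
    edge′ x∈ y∈ x≢y with ∈-++⁻ xs x∈ | ∈-++⁻ xs y∈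
    ... | inj₁ x∈K | inj₁ y∈K = edge K x∈K y∈K x≢y
    ... | inj₂ x∈L | inj₂ y∈L = edge L x∈L y∈L x≢y
    ... | inj₁ x∈K | inj₂ y∈L = proj₂ (cross x∈K y∈L)
    ... | inj₂ x∈L | inj₁ y∈K = trans (c-sym _ _) (proj₂ (cross y∈K x∈L))

  clique-recolour : ∀ {C′ : Set} {c′ : V → V → C′} {κ′ xs} → IsClique c κ xs →
    (∀ {x y} → x ∈ xs → y ∈ xs → x ≢ y → c x y ≡ κ → c′ x y ≡ κ′) → IsClique c′ κ′ xs
  clique-recolour K h = record
    { unique = unique K
    ; edge   = λ x∈ y∈ x≢y → h x∈ y∈ x≢y (edge K x∈ y∈ x≢y)
    }

clique-map⁺ : ∀ {V W C : Set} {c : W → W → C} {κ} (f : V → W) {xs} → Unique xs →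
  (∀ {x y} → x ∈ xs → y ∈ xs → x ≢ y → f x ≢ f y × c (f x) (f y) ≡ κ) →
  IsClique c κ (map f xs)
clique-map⁺ {c = c} {κ} f {xs} xs! h = record
  { unique = AllPairs.map⁺ (allPairs-∈ xs! λ x∈ y∈ x≢y → proj₁ (h x∈ y∈ x≢y))
  ; edge   = edge′
  }
  where
  edge′ : ∀ {u v} → u ∈ map f xs → v ∈ map f xs → u ≢ v → c u v ≡ κ
  edge′ u∈ v∈ u≢v with ∈-map⁻ f u∈ | ∈-map⁻ f v∈
  ... | x , x∈ , refl | y , y∈ , refl = proj₂ (h x∈ y∈ λ { refl → u≢v refl })

cliqueFree-reindex : ∀ {V W C : Set} {c : W → W → C} {κ n} (f : V → W) → Injective _≡_ _≡_ f →
  CliqueFree c κ n → CliqueFree (λ x y → c (f x) (f y)) κ n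
cliqueFree-reindex {n = n} f f-inj free {xs} K =
  subst (_< n) (length-map f xs)
    (free (clique-map⁺ f (unique K) λ x∈ y∈ x≢y → (λ eq → x≢y (f-inj eq)) , edge K x∈ y∈ x≢y))

module _ {r k} {c : Fin r → Fin r → Fin k} {κ : Fin k} where

  monoClique⇒clique : ∀ {a} → MonoClique c κ a →
    Σ (List (Fin r)) λ xs → IsClique c κ xs × length xs ≡ a
  monoClique⇒clique (f , f-inj , f-edge) = tabulate f , K , length-tabulate f
    where
    edge′ : ∀ {x y} → x ∈ tabulate f → y ∈ tabulate f → x ≢ y → c x y ≡ κ
    edge′ x∈ y∈ x≢y with ∈-tabulate⁻ x∈ | ∈-tabulate⁻ y∈
    ... | i , refl | j , refl = f-edge i j λ { refl → x≢y refl }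
    K : IsClique c κ (tabulate f)
    K = record { unique = AllPairs.tabulate⁺ (λ i≢j fi≡fj → i≢j (f-inj fi≡fj)) ; edge = edge′ }

  clique⇒monoClique : ∀ {a xs} → IsClique c κ xs → a ≤ length xs → MonoClique c κ a
  clique⇒monoClique {a} {xs} K a≤ =
    f , f-inj , λ p q p≢q → edge K (∈-lookup _) (∈-lookup _) (λ eq → p≢q (f-inj eq))
    where
    f : Fin a → Fin r
    f p = lookup xs (F.inject≤ p a≤)
    f-inj : ∀ {p q} → f p ≡ f q → p ≡ q
    f-inj eq = F.inject≤-injective a≤ a≤ _ _ (lookup-injective (unique K) eq)

  ¬monoClique⇒cliqueFree : ∀ {a} → ¬ MonoClique c κ a → CliqueFree c κ a
  ¬monoClique⇒cliqueFree ¬M K = ℕ.≰⇒> (λ a≤ → ¬M (clique⇒monoClique K a≤))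

  cliqueFree⇒¬monoClique : ∀ {a} → CliqueFree c κ a → ¬ MonoClique c κ a
  cliqueFree⇒¬monoClique free M =
    let _ , K , |K|≡a = monoClique⇒clique M in ℕ.<-irrefl |K|≡a (free K)

  monoClique-reindex : ∀ {a} {f g : Fin a → Fin r} → (∀ p → f p ≡ g p) →
    Injective _≡_ _≡_ f × (∀ p q → p ≢ q → c (f p) (f q) ≡ κ) → MonoClique c κ a
  monoClique-reindex {g = g} f≗g (f-inj , f-edge) =
    g , (λ {p} {q} eq → f-inj (trans (f≗g p) (trans eq (≡.sym (f≗g q))))) ,
    λ p q p≢q → subst₂ (λ s t → c s t ≡ κ) (f≗g p) (f≗g q) (f-edge p q p≢q)

  monoClique-recolour : ∀ {a} {c′ : Fin r → Fin r → Fin k} → (∀ x y → c x y ≡ c′ x y) →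
    MonoClique c κ a → MonoClique c′ κ a
  monoClique-recolour c≗c′ (f , f-inj , f-edge) =
    f , f-inj , λ p q p≢q → trans (≡.sym (c≗c′ _ _)) (f-edge p q p≢q)

Searchable : Set → Set₁
Searchable A = ∀ {P : A → Set} → Decidable P → Dec (∃ P)

searchable-Vec : ∀ {A : Set} → Searchable A → ∀ n → Searchable (Vec A n)
searchable-Vec search zero    P? = map′ ([] ,_) (λ { ([] , p) → p }) (P? [])
searchable-Vec search (suc n) P? =
  map′ (λ (x , xs , p) → x ∷ xs , p) (λ { (x ∷ xs , p) → x , xs , p })
       (search λ x → searchable-Vec search n (λ xs → P? (x ∷ xs)))

monoClique? : ∀ {r k} (c : Fin r → Fin r → Fin k) κ a → Dec (MonoClique c κ a)
monoClique? {r} c κ a =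
  map′ (λ (v , M) → Vec.lookup v , M)
       (λ (f , M) → Vec.tabulate f , proj₂ (monoClique-reindex {c = c} (≡.sym ∘ lookup∘tabulate f) M))
       (searchable-Vec F.any? a (isMono? ∘ Vec.lookup))
  where
  isMono? : (f : Fin a → Fin r) → Dec (Injective _≡_ _≡_ f × (∀ p q → p ≢ q → c (f p) (f q) ≡ κ))
  isMono? f =
    map′ (λ inj {p} {q} → inj p q) (λ inj p q → inj) (F.all? λ p → F.all? λ q → f p ≟ f q →-dec p ≟ q)
    ×-dec F.all? (λ p → F.all? λ q → ¬? (p ≟ q) →-dec c (f p) (f q) ≟ κ)

-- Ramsey colourings

record RamseyColouring (m a b : ℕ) : Set where
  field
    colour    : Fin m → Fin m → Fin 2
    symmetric : ∀ x y → colour x y ≡ colour y x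
    redFree   : CliqueFree colour red a
    blueFree  : CliqueFree colour blue b

ramseyColouring-restrict : ∀ {m n a b} → m ≤ n → RamseyColouring n a b → RamseyColouring m a b
ramseyColouring-restrict m≤n R = record
  { colour    = λ x y → colour (F.inject≤ x m≤n) (F.inject≤ y m≤n)
  ; symmetric = λ x y → symmetric _ _
  ; redFree   = cliqueFree-reindex _ inject-inj redFree
  ; blueFree  = cliqueFree-reindex _ inject-inj blueFree
  }
  where
  open RamseyColouring R
  inject-inj : Injective _≡_ _≡_ (λ x → F.inject≤ x m≤n)
  inject-inj = F.inject≤-injective m≤n m≤n _ _

ramseyColouring⇒¬arrows : ∀ {m a b} → RamseyColouring m a b → ¬ Arrows m a b
ramseyColouring⇒¬arrows R arrows =
  Sum.[ cliqueFree⇒¬monoClique redFree , cliqueFree⇒¬monoClique blueFree ] (arrows colour symmetric)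
  where open RamseyColouring R

module _ {m a b : ℕ} where

  private
    matrixColour : Vec (Vec (Fin 2) m) m → Fin m → Fin m → Fin 2
    matrixColour v x y = Vec.lookup (Vec.lookup v x) y

    Good : Vec (Vec (Fin 2) m) m → Set
    Good v = (∀ x y → matrixColour v x y ≡ matrixColour v y x)
           × ¬ MonoClique (matrixColour v) red a × ¬ MonoClique (matrixColour v) blue b

    good? : Decidable Good
    good? v = F.all? (λ x → F.all? λ y → matrixColour v x y ≟ matrixColour v y x)
      ×-dec ¬? (monoClique? (matrixColour v) red a) ×-dec ¬? (monoClique? (matrixColour v) blue b)

    ∄good⇒arrows : ¬ ∃ Good → Arrows m a b
    ∄good⇒arrows ∄good c c-sym with monoClique? c red a | monoClique? c blue b
    ... | yes M | _     = inj₁ M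
    ... | no _  | yes M = inj₂ M
    ... | no ¬R | no ¬B = ⊥-elim (∄good (v , v-sym , ¬R ∘ monoClique-recolour v≗c , ¬B ∘ monoClique-recolour v≗c))
      where
      v : Vec (Vec (Fin 2) m) m
      v = Vec.tabulate (Vec.tabulate ∘ c)
      v≗c : ∀ x y → matrixColour v x y ≡ c x y
      v≗c x y = trans (cong (λ row → Vec.lookup row y) (lookup∘tabulate _ x)) (lookup∘tabulate _ y)
      v-sym : ∀ x y → matrixColour v x y ≡ matrixColour v y x
      v-sym x y = trans (v≗c x y) (trans (c-sym x y) (≡.sym (v≗c y x)))

  ¬arrows⇒ramseyColouring : ¬ Arrows m a b → RamseyColouring m a b
  ¬arrows⇒ramseyColouring ¬arrows with searchable-Vec (searchable-Vec F.any? m) m good?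
  ... | yes (v , v-sym , ¬R , ¬B) = record
    { colour    = matrixColour v
    ; symmetric = v-sym
    ; redFree   = ¬monoClique⇒cliqueFree ¬R
    ; blueFree  = ¬monoClique⇒cliqueFree ¬B
    }
  ... | no ∄good = ⊥-elim (¬arrows (∄good⇒arrows ∄good))

¬arrows-0 : ∀ {a b} → 1 ≤ a → 1 ≤ b → ¬ Arrows 0 a b
¬arrows-0 {suc _} {suc _} _ _ arrows =
  Sum.[ (λ (f , _) → case f 0F of λ ()) , (λ (f , _) → case f 0F of λ ()) ] (arrows (λ ()) (λ ()))

ramseyColouring⇒hasFeasible : ∀ {a₁ a₂ a₃ m} → 2 ≤ a₁ → RamseyColouring m a₂ a₃ →
  HasFeasible (a₁ ∷ a₂ ∷ a₃ ∷ []) m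
ramseyColouring⇒hasFeasible (s≤s (s≤s _)) R = ξ , noClique , λ x y x≢y ()
  where
  open RamseyColouring R
  ξ : Colouring 3 _
  ξ = record { pair = λ x y → F.suc (colour x y) ; sym = λ x y → cong F.suc (symmetric x y) ; single = λ _ → 0F }
  noClique : ∀ i → ¬ MonoClique (pair ξ) i (Vec.lookup (_ ∷ _ ∷ _ ∷ []) i)
  noClique 0F (f , _ , f-edge) = case f-edge 0F 1F (λ ()) of λ ()
  noClique 1F (f , f-inj , f-edge) =
    cliqueFree⇒¬monoClique redFree (f , f-inj , λ p q p≢q → F.suc-injective (f-edge p q p≢q))
  noClique 2F (f , f-inj , f-edge) =
    cliqueFree⇒¬monoClique blueFree (f , f-inj , λ p q p≢q → F.suc-injective (f-edge p q p≢q))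

-- Extending a colouring across a monochromatic cut

other : Fin 2 → Fin 2
other red  = blue
other blue = red

other-≢ : ∀ κ → other κ ≢ κ
other-≢ red  ()
other-≢ blue ()

record MonochromaticCut {r} (χ : Fin r → Fin r → Fin 2) (κ : Fin 2) : Set₁ where
  field
    Side       : Fin r → Set
    side?      : Decidable Side
    crossing   : ∀ {x y} → Side x → ¬ Side y → χ x y ≡ κ
    inner      : Fin r
    outer      : Fin r
    inner-side : Side inner
    outer-side : ¬ Side outer

module Extension {r} {χ : Fin r → Fin r → Fin 2} (χ-sym : ∀ x y → χ x y ≡ χ y x)
  {κ} (C : MonochromaticCut χ κ) where

  open MonochromaticCut C
  open DecMembership (F._≟_ {suc r}) using (_∈?_)

  Endpoint : Fin r → Set
  Endpoint y = y ≡ inner ⊎ y ≡ outer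

  endpoint? : Decidable Endpoint
  endpoint? y = y ≟ inner ⊎-dec y ≟ outer

  Special : Fin r → Fin r → Set
  Special x y = (x ≡ inner × y ≡ outer) ⊎ (x ≡ outer × y ≡ inner)

  special? : ∀ x y → Dec (Special x y)
  special? x y = (x ≟ inner ×-dec y ≟ outer) ⊎-dec (x ≟ outer ×-dec y ≟ inner)

  partner : Fin r → Fin r
  partner y with side? y
  ... | yes _ = inner
  ... | no  _ = outer

  oldEdge : Fin r → Fin r → Fin 2
  oldEdge x y with special? x y
  ... | yes _ = other κ
  ... | no  _ = χ x y

  newEdge : Fin r → Fin 2
  newEdge y with endpoint? y
  ... | yes _ = κ
  ... | no  _ = χ (partner y) y

  -- The new vertex 0F behaves like `inner` towards the inner side and like `outer` towards the
  -- outer side, and has colour κ to both; the cut edge between `inner` and `outer` is recoloured.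
  χ⁺ : Fin (suc r) → Fin (suc r) → Fin 2
  χ⁺ 0F        0F        = κ
  χ⁺ 0F        (F.suc y) = newEdge y
  χ⁺ (F.suc x) 0F        = newEdge x
  χ⁺ (F.suc x) (F.suc y) = oldEdge x y

  inner≢outer : inner ≢ outer
  inner≢outer eq = outer-side (subst Side eq inner-side)

  partner-inner : ∀ {y} → Side y → partner y ≡ inner
  partner-inner {y} sy with side? y
  ... | yes _  = refl
  ... | no ¬sy = ⊥-elim (¬sy sy)

  partner-outer : ∀ {y} → ¬ Side y → partner y ≡ outer
  partner-outer {y} ¬sy with side? y
  ... | yes sy = ⊥-elim (¬sy sy)
  ... | no _   = refl

  partner-endpoint : ∀ {y} → Endpoint y → partner y ≡ y
  partner-endpoint (inj₁ refl) = partner-inner inner-side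
  partner-endpoint (inj₂ refl) = partner-outer outer-side

  partner-or-crossing : ∀ {w} y → Endpoint w → partner y ≡ w ⊎ χ w y ≡ κ
  partner-or-crossing y ew with side? y | ew
  ... | yes _  | inj₁ refl = inj₁ refl
  ... | yes sy | inj₂ refl = inj₂ (trans (χ-sym _ _) (crossing sy outer-side))
  ... | no ¬sy | inj₁ refl = inj₂ (crossing inner-side ¬sy)
  ... | no _   | inj₂ refl = inj₁ refl

  crossing-to-endpoint : ∀ y → χ inner y ≡ κ ⊎ χ outer y ≡ κ
  crossing-to-endpoint y with side? y
  ... | yes sy = inj₂ (trans (χ-sym _ _) (crossing sy outer-side))
  ... | no ¬sy = inj₁ (crossing inner-side ¬sy)

  newEdge-endpoint : ∀ {y} → Endpoint y → newEdge y ≡ κ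
  newEdge-endpoint {y} ey with endpoint? y
  ... | yes _  = refl
  ... | no ¬ey = ⊥-elim (¬ey ey)

  newEdge-nonEndpoint : ∀ {y} → ¬ Endpoint y → newEdge y ≡ χ (partner y) y
  newEdge-nonEndpoint {y} ¬ey with endpoint? y
  ... | yes ey = ⊥-elim (¬ey ey)
  ... | no _   = refl

  oldEdge-special : ∀ {x y} → Special x y → oldEdge x y ≡ other κ
  oldEdge-special {x} {y} s with special? x y
  ... | yes _ = refl
  ... | no ¬s = ⊥-elim (¬s s)

  oldEdge-ordinary : ∀ {x y} → ¬ Special x y → oldEdge x y ≡ χ x y
  oldEdge-ordinary {x} {y} ¬s with special? x y
  ... | yes s = ⊥-elim (¬s s)
  ... | no _  = refl

  ¬special : ∀ {w x y} → Endpoint w → x ≢ w → y ≢ w → ¬ Special x y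
  ¬special (inj₁ refl) x≢w y≢w (inj₁ (x≡w , _)) = x≢w x≡w
  ¬special (inj₁ refl) x≢w y≢w (inj₂ (_ , y≡w)) = y≢w y≡w
  ¬special (inj₂ refl) x≢w y≢w (inj₁ (_ , y≡w)) = y≢w y≡w
  ¬special (inj₂ refl) x≢w y≢w (inj₂ (x≡w , _)) = x≢w x≡w

  special-sym : ∀ {x y} → Special x y → Special y x
  special-sym = Sum.swap ∘ Sum.map Prod.swap Prod.swap

  χ⁺-sym : ∀ x y → χ⁺ x y ≡ χ⁺ y x
  χ⁺-sym 0F        0F        = refl
  χ⁺-sym 0F        (F.suc y) = refl
  χ⁺-sym (F.suc x) 0F        = refl
  χ⁺-sym (F.suc x) (F.suc y) with special? x y | special? y x
  ... | yes _ | yes _ = refl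
  ... | no _  | no _  = χ-sym x y
  ... | yes s | no ¬s = ⊥-elim (¬s (special-sym s))
  ... | no ¬s | yes s = ⊥-elim (¬s (special-sym s))

  ¬special-nonEndpoint : ∀ {x y} → ¬ Endpoint x → ¬ Special x y
  ¬special-nonEndpoint ¬ex (inj₁ (x≡inner , _)) = ¬ex (inj₁ x≡inner)
  ¬special-nonEndpoint ¬ex (inj₂ (x≡outer , _)) = ¬ex (inj₂ x≡outer)

  ordinary-edge : ∀ {c K x y} → IsClique χ⁺ c K → F.suc x ∈ K → F.suc y ∈ K → x ≢ y →
    ¬ Special x y → χ x y ≡ c
  ordinary-edge K-clique x∈ y∈ x≢y ¬s =
    trans (≡.sym (oldEdge-ordinary ¬s)) (edge K-clique x∈ y∈ (x≢y ∘ F.suc-injective))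

  mergeInto : Fin r → Fin (suc r) → Fin r
  mergeInto w 0F        = w
  mergeInto w (F.suc y) = y

  mergeInto-< : ∀ {c p K w} → Endpoint w → F.suc w ∉ K → IsClique χ⁺ c K →
    (∀ {y} → 0F ∈ K → F.suc y ∈ K → y ≢ w → newEdge y ≡ c → χ w y ≡ c) →
    CliqueFree χ c p → length K < p
  mergeInto-< {c} {p} {K} {w} ew w∉K K-clique newEdge⇒ free =
    subst (_< p) (length-map (mergeInto w) K) (free (clique-map⁺ (mergeInto w) (unique K-clique) merged))
    where
    ≢w : ∀ {y} → F.suc y ∈ K → y ≢ w
    ≢w y∈ refl = w∉K y∈
    merged : ∀ {x y} → x ∈ K → y ∈ K → x ≢ y →
      mergeInto w x ≢ mergeInto w y × χ (mergeInto w x) (mergeInto w y) ≡ c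
    merged {0F}      {0F}      _  _  x≢y = ⊥-elim (x≢y refl)
    merged {0F}      {F.suc y} 0∈ y∈ _   =
      ≢w y∈ ∘ ≡.sym , newEdge⇒ 0∈ y∈ (≢w y∈) (edge K-clique 0∈ y∈ λ ())
    merged {F.suc x} {0F}      x∈ 0∈ _   =
      ≢w x∈ , trans (χ-sym _ _) (newEdge⇒ 0∈ x∈ (≢w x∈) (edge K-clique 0∈ x∈ λ ()))
    merged {F.suc x} {F.suc y} x∈ y∈ sx≢sy =
      let x≢y = sx≢sy ∘ cong F.suc in
      x≢y , ordinary-edge K-clique x∈ y∈ x≢y (¬special ew (≢w x∈) (≢w y∈))

  newEdge⇒κ : ∀ {w y} → Endpoint w → y ≢ w → newEdge y ≡ κ → χ w y ≡ κ
  newEdge⇒κ {w} {y} ew y≢w eq with partner-or-crossing y ew | endpoint? y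
  ... | inj₂ cross | _      = cross
  ... | inj₁ py≡w  | yes ey = ⊥-elim (y≢w (trans (≡.sym (partner-endpoint ey)) py≡w))
  ... | inj₁ py≡w  | no _   = subst (λ z → χ z y ≡ κ) py≡w eq

  κ-free : ∀ {p} → CliqueFree χ κ p → CliqueFree χ⁺ κ p
  κ-free free {K} K-clique with F.suc inner ∈? K
  ... | no inner∉ = mergeInto-< (inj₁ refl) inner∉ K-clique (λ _ _ → newEdge⇒κ (inj₁ refl)) free
  ... | yes inner∈ = mergeInto-< (inj₂ refl) outer∉ K-clique (λ _ _ → newEdge⇒κ (inj₂ refl)) free
    where
    outer∉ : F.suc outer ∉ K
    outer∉ outer∈ = other-≢ κ (trans (≡.sym (oldEdge-special (inj₁ (refl , refl))))
                                     (edge K-clique inner∈ outer∈ (inner≢outer ∘ F.suc-injective)))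

  onOld : (Fin r → Set) → Fin (suc r) → Set
  onOld P 0F        = ⊥
  onOld P (F.suc y) = P y

  onOld? : ∀ {P} → Decidable P → Decidable (onOld P)
  onOld? P? 0F        = no λ ()
  onOld? P? (F.suc y) = P? y

  other-free-without-new : ∀ {q K} → 3 ≤ q → 0F ∉ K → IsClique χ⁺ (other κ) K →
    CliqueFree χ (other κ) q → length K < q
  other-free-without-new {K = K} 3≤q 0∉ K-clique free with F.suc inner ∈? K | F.suc outer ∈? K
  ... | no inner∉ | _         = mergeInto-< (inj₁ refl) inner∉ K-clique (λ 0∈ → ⊥-elim (0∉ 0∈)) free
  ... | yes _     | no outer∉ = mergeInto-< (inj₂ refl) outer∉ K-clique (λ 0∈ → ⊥-elim (0∉ 0∈)) free
  -- {inner, outer} is a new clique of colour `other κ`, and nothing can be added to it.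
  ... | yes inner∈ | yes outer∈ =
    ℕ.≤-<-trans (unique-length≤2 (unique K-clique) (All.tabulate endpoints)) 3≤q
    where
    endpoints : ∀ {k} → k ∈ K → k ≡ F.suc inner ⊎ k ≡ F.suc outer
    endpoints {0F}      0∈ = ⊥-elim (0∉ 0∈)
    endpoints {F.suc y} y∈ with endpoint? y
    ... | yes (inj₁ refl) = inj₁ refl
    ... | yes (inj₂ refl) = inj₂ refl
    ... | no ¬ey =
      ⊥-elim (Sum.[ to-κ (inj₁ refl) inner∈ , to-κ (inj₂ refl) outer∈ ] (crossing-to-endpoint y))
      where
      to-κ : ∀ {w} → Endpoint w → F.suc w ∈ K → χ w y ≢ κ
      to-κ ew w∈ wy≡κ = other-≢ κ
        (trans (≡.sym (ordinary-edge K-clique y∈ w∈ (λ { refl → ¬ey ew }) (¬special-nonEndpoint ¬ey)))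
               (trans (χ-sym y _) wy≡κ))

  other-free-with-new : ∀ {q K} → 0F ∈ K → IsClique χ⁺ (other κ) K →
    CliqueFree χ (other κ) q → length K < q
  other-free-with-new {K = K} 0∈ K-clique free =
    Sum.[ (λ all-outer → mergeInto-< (inj₂ refl) (endpoint∉ (inj₂ refl)) K-clique
            (λ _ y∈ _ → viaPartner y∈ (partner-outer (All.lookup all-outer y∈))) free)
        , (λ all-inner → mergeInto-< (inj₁ refl) (endpoint∉ (inj₁ refl)) K-clique
            (λ _ y∈ _ → viaPartner y∈ (partner-inner (decidable-stable (side? _) (All.lookup all-inner y∈))))
            free)
        ] (avoids-one (onOld? side?) mixed)
    where
    endpoint∉ : ∀ {w} → Endpoint w → F.suc w ∉ K
    endpoint∉ ew w∈ = other-≢ κ (trans (≡.sym (edge K-clique 0∈ w∈ λ ())) (newEdge-endpoint ew))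
    nonEndpoint : ∀ {y} → F.suc y ∈ K → ¬ Endpoint y
    nonEndpoint y∈ ey = endpoint∉ ey y∈
    mixed : ∀ {x y} → x ∈ K → y ∈ K → onOld Side x → onOld (∁ Side) y → ⊥
    mixed {F.suc x} {F.suc y} x∈ y∈ sx ¬sy = other-≢ κ
      (trans (≡.sym (ordinary-edge K-clique x∈ y∈ (λ { refl → ¬sy sx }) (¬special-nonEndpoint (nonEndpoint x∈))))
             (crossing sx ¬sy))
    viaPartner : ∀ {w y} → F.suc y ∈ K → partner y ≡ w → newEdge y ≡ other κ → χ w y ≡ other κ
    viaPartner {y = y} y∈ py≡w eq =
      subst (λ z → χ z y ≡ other κ) py≡w (trans (≡.sym (newEdge-nonEndpoint (nonEndpoint y∈))) eq)

  other-free : ∀ {q} → 3 ≤ q → CliqueFree χ (other κ) q → CliqueFree χ⁺ (other κ) q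
  other-free 3≤q free {K} K-clique with 0F ∈? K
  ... | yes 0∈ = other-free-with-new 0∈ K-clique free
  ... | no 0∉  = other-free-without-new 3≤q 0∉ K-clique free

ramseyColouring-extend : ∀ {r a b κ} (R : RamseyColouring r a b) → 3 ≤ a → 3 ≤ b →
  MonochromaticCut (RamseyColouring.colour R) κ → RamseyColouring (suc r) a b
ramseyColouring-extend {κ = red} R 3≤a 3≤b C = record
  { colour = χ⁺ ; symmetric = χ⁺-sym ; redFree = κ-free redFree ; blueFree = other-free 3≤b blueFree }
  where open RamseyColouring R
        open Extension symmetric C
ramseyColouring-extend {κ = blue} R 3≤a 3≤b C = record
  { colour = χ⁺ ; symmetric = χ⁺-sym ; redFree = other-free 3≤a redFree ; blueFree = κ-free blueFree }
  where open RamseyColouring R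
        open Extension symmetric C

-- Collapsing a feasible colouring to two colours

third-colour : ∀ {u v c d : Fin 3} → u ≢ v → c ≢ u → c ≢ v → d ≢ u → d ≢ v → c ≡ d
third-colour {u} {v} {c} {d} = from-yes
  (F.all? {n = 3} λ u → F.all? {n = 3} λ v → F.all? {n = 3} λ c → F.all? {n = 3} λ d →
    ¬? (u ≟ v) →-dec ¬? (c ≟ u) →-dec ¬? (c ≟ v) →-dec ¬? (d ≟ u) →-dec ¬? (d ≟ v) →-dec c ≟ d) u v c d

exchange-arith : ∀ {a b c d m} → a + d < m → b + c < m → m ≤ b + d → a + c < m
exchange-arith {a} {b} {c} {d} a+d<m b+c<m m≤b+d =
  ℕ.<-trans (ℕ.+-monoˡ-< c (ℕ.+-cancelʳ-< d a b (ℕ.<-≤-trans a+d<m m≤b+d))) b+c<m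

blueLabel : Fin 3 → Fin 3 → Fin 3 → Fin 3
blueLabel u 2F 2F = u
blueLabel u _  _  = 2F

blueLabel-small : ∀ u {i j} → i ≢ 2F ⊎ j ≢ 2F → blueLabel u i j ≡ 2F
blueLabel-small u {0F}      _          = refl
blueLabel-small u {1F}      _          = refl
blueLabel-small u {2F} {0F} _          = refl
blueLabel-small u {2F} {1F} _          = refl
blueLabel-small u {2F} {2F} (inj₁ i≢2) = ⊥-elim (i≢2 refl)
blueLabel-small u {2F} {2F} (inj₂ j≢2) = ⊥-elim (j≢2 refl)

blueLabel-sym : ∀ u i j → blueLabel u i j ≡ blueLabel u j i
blueLabel-sym u i j with i ≟ 2F | j ≟ 2F
... | yes refl | yes refl = refl
... | no i≢2   | _        = trans (blueLabel-small u (inj₁ i≢2)) (≡.sym (blueLabel-small u (inj₂ i≢2)))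
... | yes _    | no j≢2   = trans (blueLabel-small u (inj₂ j≢2)) (≡.sym (blueLabel-small u (inj₁ j≢2)))

blueIfEqual : Fin 3 → Fin 3 → Fin 2
blueIfEqual c d with c ≟ d
... | yes _ = blue
... | no _  = red

blueIfEqual-blue : ∀ {c d} → blueIfEqual c d ≡ blue → c ≡ d
blueIfEqual-blue {c} {d} eq with c ≟ d
... | yes c≡d = c≡d
... | no _    = case eq of λ ()

blueIfEqual-red : ∀ {c d} → blueIfEqual c d ≡ red → c ≢ d
blueIfEqual-red {c} {d} eq with c ≟ d
... | yes _   = case eq of λ ()
... | no c≢d  = c≢d

blueIfEqual-≡ : ∀ {c d} → c ≡ d → blueIfEqual c d ≡ blue
blueIfEqual-≡ {c} {d} c≡d with c ≟ d
... | yes _  = refl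
... | no c≢d = ⊥-elim (c≢d c≡d)

blueIfEqual-≢ : ∀ {c d} → c ≢ d → blueIfEqual c d ≡ red
blueIfEqual-≢ {c} {d} c≢d with c ≟ d
... | yes c≡d = ⊥-elim (c≢d c≡d)
... | no _    = refl

-- Both colours 0 and 1 are only assumed to be free of K_m, which makes the development symmetric
-- in them; 0 and 1 are called small and 2 large, and so are the classes.
module Collapse {r m n} (ξ : Colouring 3 r)
  (proper    : ∀ x y → x ≢ y → pair ξ x y ≢ single ξ x)
  (smallFree : ∀ {c} → c ≢ 2F → CliqueFree (pair ξ) c m)
  (largeFree : CliqueFree (pair ξ) 2F n)
  (m≤n       : m ≤ n) where

  collapse : Fin 3 → Fin r → Fin r → Fin 2
  collapse u x y = blueIfEqual (pair ξ x y) (blueLabel u (single ξ x) (single ξ y))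

  collapse-sym : ∀ u x y → collapse u x y ≡ collapse u y x
  collapse-sym u x y = cong₂ blueIfEqual (Colouring.sym ξ x y) (blueLabel-sym u _ _)

  pair≢singleʳ : ∀ {x y} → x ≢ y → pair ξ x y ≢ single ξ y
  pair≢singleʳ {x} {y} x≢y eq = proper y x (x≢y ∘ ≡.sym) (trans (Colouring.sym ξ y x) eq)

  classes-differ : ∀ {x y} → single ξ x ≢ single ξ y → x ≢ y
  classes-differ sx≢sy refl = sx≢sy refl

  pair-across : ∀ {x y i j k} → x ≢ y → single ξ x ≡ i → single ξ y ≡ j →
    i ≢ j → k ≢ i → k ≢ j → pair ξ x y ≡ k
  pair-across x≢y refl refl i≢j = third-colour i≢j (proper _ _ x≢y) (pair≢singleʳ x≢y)

  smalls-blue : ∀ {u x y} → single ξ x ≢ single ξ y → single ξ x ≢ 2F → single ξ y ≢ 2F →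
    collapse u x y ≡ blue
  smalls-blue {u} sx≢sy sx≢2 sy≢2 = blueIfEqual-≡
    (trans (pair-across (classes-differ sx≢sy) refl refl sx≢sy (sx≢2 ∘ ≡.sym) (sy≢2 ∘ ≡.sym))
           (≡.sym (blueLabel-small u (inj₁ sx≢2))))

  large-small-red : ∀ {u x y} → single ξ x ≡ 2F → single ξ y ≢ 2F → collapse u x y ≡ red
  large-small-red {u} {x} {y} sx≡2 sy≢2 = blueIfEqual-≢ λ eq →
    proper x y (classes-differ λ sx≡sy → sy≢2 (trans (≡.sym sx≡sy) sx≡2))
      (trans eq (trans (blueLabel-small u (inj₂ sy≢2)) (≡.sym sx≡2)))

  red-from-small : ∀ {u x y i j} → x ≢ y → single ξ x ≡ i → i ≢ 2F → j ≢ i → j ≢ 2F →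
    collapse u x y ≡ red → pair ξ x y ≡ j
  red-from-small {u} x≢y refl i≢2 j≢i j≢2 red-edge =
    third-colour i≢2 (proper _ _ x≢y)
      (λ p≡2 → blueIfEqual-red red-edge (trans p≡2 (≡.sym (blueLabel-small u (inj₁ i≢2))))) j≢i j≢2

  red-within-large : ∀ {u v x y} → x ≢ y → single ξ x ≡ 2F → single ξ y ≡ 2F →
    u ≢ 2F → v ≢ u → v ≢ 2F → collapse u x y ≡ red → pair ξ x y ≡ v
  red-within-large {u} x≢y sx≡2 sy≡2 u≢2 v≢u v≢2 red-edge =
    third-colour u≢2
      (λ p≡u → blueIfEqual-red red-edge (trans p≡u (≡.sym (cong₂ (blueLabel u) sx≡2 sy≡2))))
      (λ p≡2 → proper _ _ x≢y (trans p≡2 (≡.sym sx≡2))) v≢u v≢2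

  class? : ∀ i → Decidable (λ x → single ξ x ≡ i)
  class? i x = single ξ x ≟ i

  ofClass notOfClass : Fin 3 → List (Fin r) → List (Fin r)
  ofClass    i = filter (class? i)
  notOfClass i = filter (∁? (class? i))

  module _ {u v : Fin 3} (u≢v : u ≢ v) (u≢2 : u ≢ 2F) (v≢2 : v ≢ 2F) where

    large : ∀ {x} → single ξ x ≢ u → single ξ x ≢ v → single ξ x ≡ 2F
    large sx≢u sx≢v = third-colour u≢v sx≢u sx≢v (u≢2 ∘ ≡.sym) (v≢2 ∘ ≡.sym)

    notOfClass-large : ∀ {K x} → All (λ x → single ξ x ≢ u) K → x ∈ notOfClass v K →
      single ξ x ≡ 2F
    notOfClass-large {K} K≢u x∈ =
      let x∈K , sx≢v = ∈-filter⁻ (∁? (class? v)) {xs = K} x∈ in large (All.lookup K≢u x∈K) sx≢v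

    redClique-avoids : ∀ {w K} → IsClique (collapse w) red K →
      All (λ x → single ξ x ≢ u) K ⊎ All (λ x → single ξ x ≢ v) K
    redClique-avoids K-clique = avoids-one (class? u) λ x∈ y∈ sx≡u sy≡v →
      let sx≢sy = λ sx≡sy → u≢v (trans (≡.sym sx≡u) (trans sx≡sy sy≡v)) in
      case trans (≡.sym (edge K-clique x∈ y∈ (classes-differ sx≢sy)))
                 (smalls-blue sx≢sy (u≢2 ∘ trans (≡.sym sx≡u)) (v≢2 ∘ trans (≡.sym sy≡v)))
      of λ ()

    redClique-colour : ∀ {K} → IsClique (collapse u) red K → All (λ x → single ξ x ≢ v) K →
      IsClique (pair ξ) v K
    redClique-colour K-clique K≢v = clique-recolour K-clique λ x∈ y∈ x≢y red-edge →
      red-edge-colour x≢y (All.lookup K≢v x∈) (All.lookup K≢v y∈) red-edge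
      where
      red-edge-colour : ∀ {x y} → x ≢ y → single ξ x ≢ v → single ξ y ≢ v →
        collapse u x y ≡ red → pair ξ x y ≡ v
      red-edge-colour {x} {y} x≢y sx≢v sy≢v red-edge
        with single ξ x ≟ u | single ξ y ≟ u
      ... | yes sx≡u | _        = red-from-small x≢y sx≡u u≢2 (u≢v ∘ ≡.sym) v≢2 red-edge
      ... | no _     | yes sy≡u =
        trans (Colouring.sym ξ x y)
          (red-from-small (x≢y ∘ ≡.sym) sy≡u u≢2 (u≢v ∘ ≡.sym) v≢2
            (trans (collapse-sym u y x) red-edge))
      ... | no sx≢u  | no sy≢u  =
        red-within-large x≢y (large sx≢u sx≢v) (large sy≢u sy≢v) u≢2 (u≢v ∘ ≡.sym) v≢2 red-edge

    redClique-split : ∀ {K} → IsClique (collapse u) red K → All (λ x → single ξ x ≢ u) K →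
      IsClique (pair ξ) u (ofClass v K) × IsClique (pair ξ) v (notOfClass v K)
    redClique-split {K} K-clique K≢u =
      clique-recolour (clique-filter⁺ (class? v) K-clique) (λ x∈ _ x≢y →
        red-from-small x≢y (proj₂ (∈-filter⁻ (class? v) {xs = K} x∈)) v≢2 u≢v u≢2) ,
      clique-recolour (clique-filter⁺ (∁? (class? v)) K-clique) (λ x∈ y∈ x≢y →
        red-within-large x≢y (notOfClass-large K≢u x∈) (notOfClass-large K≢u y∈)
          u≢2 (u≢v ∘ ≡.sym) v≢2)

  ofClass-class : ∀ {i K x} → x ∈ ofClass i K → single ξ x ≡ i
  ofClass-class {i} {K} x∈ = proj₂ (∈-filter⁻ (class? i) {xs = K} x∈)

  across-union-< : ∀ {i j A B} → i ≢ 2F → j ≢ i → j ≢ 2F →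
    IsClique (pair ξ) j A → IsClique (pair ξ) j B →
    (∀ {x} → x ∈ A → single ξ x ≡ i) → (∀ {y} → y ∈ B → single ξ y ≡ 2F) →
    length A + length B < m
  across-union-< {i} {j} {A} {B} i≢2 j≢i j≢2 A-clique B-clique A-class B-class =
    subst (_< m) (length-++ A)
      (smallFree j≢2 (clique-++⁺ (Colouring.sym ξ) A-clique B-clique across))
    where
    across : ∀ {x y} → x ∈ A → y ∈ B → x ≢ y × pair ξ x y ≡ j
    across x∈ y∈ =
      let x≢y = classes-differ λ sx≡sy → i≢2 (trans (≡.sym (A-class x∈)) (trans sx≡sy (B-class y∈)))
      in x≢y , pair-across x≢y (A-class x∈) (B-class y∈) i≢2 j≢i j≢2

  -- M avoids class u and L avoids class v. The class-u part of L together with the class-2 part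
  -- of M is a ξ-clique of colour v, and symmetrically, so both unions have fewer than m vertices.
  redFree-exchange : ∀ {u v M} → u ≢ v → u ≢ 2F → v ≢ 2F →
    IsClique (collapse u) red M → m ≤ length M → CliqueFree (collapse v) red m
  redFree-exchange {u} {v} {M} u≢v u≢2 v≢2 M-clique m≤|M| {L} L-clique
    with redClique-avoids u≢v u≢2 v≢2 M-clique | redClique-avoids (u≢v ∘ ≡.sym) v≢2 u≢2 L-clique
  ... | inj₂ M≢v | _        =
    ⊥-elim (ℕ.<⇒≱ (smallFree v≢2 (redClique-colour u≢v u≢2 v≢2 M-clique M≢v)) m≤|M|)
  ... | inj₁ _   | inj₂ L≢u = smallFree u≢2 (redClique-colour (u≢v ∘ ≡.sym) v≢2 u≢2 L-clique L≢u)
  ... | inj₁ M≢u | inj₁ L≢v =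
    subst (_< m) (length-filter+∁ (class? u) L)
      (exchange-arith {length (ofClass u L)} {length (ofClass v M)}
                      {length (notOfClass u L)} {length (notOfClass v M)}
        (across-union-< u≢2 v≢u v≢2 Lᵤ M₂ (ofClass-class {K = L}) (notOfClass-large u≢v u≢2 v≢2 {K = M} M≢u))
        (across-union-< v≢2 u≢v u≢2 Mᵥ L₂ (ofClass-class {K = M}) (notOfClass-large v≢u v≢2 u≢2 {K = L} L≢v))
        (subst (m ≤_) (≡.sym (length-filter+∁ (class? v) M)) m≤|M|))
    where
    v≢u = u≢v ∘ ≡.sym
    Mᵥ = proj₁ (redClique-split u≢v u≢2 v≢2 M-clique M≢u)
    M₂ = proj₂ (redClique-split u≢v u≢2 v≢2 M-clique M≢u)
    Lᵤ = proj₁ (redClique-split v≢u v≢2 u≢2 L-clique L≢v)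
    L₂ = proj₂ (redClique-split v≢u v≢2 u≢2 L-clique L≢v)

  collapse-blueFree : ∀ {u} → u ≢ 2F → CliqueFree (collapse u) blue n
  collapse-blueFree {u} u≢2 {K} K-clique =
    Sum.[ (λ K-small → largeFree (clique-recolour K-clique λ {x} x∈ _ _ blue-edge →
            trans (blueIfEqual-blue blue-edge) (blueLabel-small u (inj₁ (All.lookup K-small x∈)))))
        , (λ K-large → ℕ.<-≤-trans (smallFree u≢2 (clique-recolour K-clique λ x∈ y∈ _ blue-edge →
            trans (blueIfEqual-blue blue-edge)
                  (cong₂ (blueLabel u) (isLarge K-large x∈) (isLarge K-large y∈)))) m≤n)
        ] (avoids-one (class? 2F) mixed)
    where
    isLarge : All (λ x → ¬ single ξ x ≢ 2F) K → ∀ {x} → x ∈ K → single ξ x ≡ 2F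
    isLarge K-large x∈ = decidable-stable (class? 2F _) (All.lookup K-large x∈)
    mixed : ∀ {x y} → x ∈ K → y ∈ K → single ξ x ≡ 2F → single ξ y ≢ 2F → ⊥
    mixed x∈ y∈ sx≡2 sy≢2 =
      case trans (≡.sym (edge K-clique x∈ y∈ (classes-differ (sy≢2 ∘ λ sx≡sy → trans (≡.sym sx≡sy) sx≡2))))
                 (large-small-red sx≡2 sy≢2)
      of λ ()

  collapse-ramseyColouring : ∀ {u} → u ≢ 2F → CliqueFree (collapse u) red m → RamseyColouring r m n
  collapse-ramseyColouring {u} u≢2 redFree = record
    { colour    = collapse u
    ; symmetric = collapse-sym u
    ; redFree   = redFree
    ; blueFree  = collapse-blueFree u≢2
    }

  redFree-collapse : ∃ λ u → u ≢ 2F × CliqueFree (collapse u) red m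
  redFree-collapse with monoClique? (collapse 0F) red m
  ... | no ¬M = 0F , (λ ()) , ¬monoClique⇒cliqueFree ¬M
  ... | yes M =
    let _ , M-clique , |M|≡m = monoClique⇒clique M
    in 1F , (λ ()) , redFree-exchange (λ ()) (λ ()) (λ ()) M-clique (ℕ.≤-reflexive (≡.sym |M|≡m))

  collapse-cut : ∀ u {x y} → single ξ x ≢ single ξ y → ∃ λ κ → MonochromaticCut (collapse u) κ
  collapse-cut u {x} {y} sx≢sy with F.any? (class? 2F)
  ... | yes (z , sz≡2) = red , record
    { Side = λ w → single ξ w ≡ 2F ; side? = class? 2F ; crossing = large-small-red
    ; inner = z ; outer = proj₁ small ; inner-side = sz≡2 ; outer-side = proj₂ small }
    where
    small : ∃ λ w → single ξ w ≢ 2F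
    small with single ξ x ≟ 2F
    ... | yes sx≡2 = y , λ sy≡2 → sx≢sy (trans sx≡2 (≡.sym sy≡2))
    ... | no sx≢2  = x , sx≢2
  ... | no ∄large = blue , record
    { Side = λ w → single ξ w ≡ single ξ x ; side? = class? (single ξ x)
    ; crossing = λ {a} {b} sa ¬sb →
        smalls-blue (λ sa≡sb → ¬sb (trans (≡.sym sa≡sb) sa)) (small a) (small b)
    ; inner = x ; outer = y ; inner-side = refl ; outer-side = sx≢sy ∘ ≡.sym }
    where
    small : ∀ w → single ξ w ≢ 2F
    small w sw≡2 = ∄large (w , sw≡2)

  ramseyColouring : RamseyColouring r m n
  ramseyColouring = let _ , u≢2 , redFree = redFree-collapse in collapse-ramseyColouring u≢2 redFree

  ramseyColouring-suc : 3 ≤ m → ∀ {x y} → single ξ x ≢ single ξ y → RamseyColouring (suc r) m n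
  ramseyColouring-suc 3≤m sx≢sy =
    let u , u≢2 , redFree = redFree-collapse
        _ , cut           = collapse-cut u sx≢sy
    in ramseyColouring-extend (collapse-ramseyColouring u≢2 redFree) 3≤m (ℕ.≤-trans 3≤m m≤n) cut

module _ {a₁ a₂ a₃ r} (a₁≤a₂ : a₁ ≤ a₂) (a₂≤a₃ : a₂ ≤ a₃) (ξ : Colouring 3 r)
  (feasible : Feasible (a₁ ∷ a₂ ∷ a₃ ∷ []) ξ) where

  private
    smallFree : ∀ {c} → c ≢ 2F → CliqueFree (pair ξ) c a₂
    smallFree {0F} _ K = ℕ.<-≤-trans (¬monoClique⇒cliqueFree (proj₁ feasible 0F) K) a₁≤a₂
    smallFree {1F} _   = ¬monoClique⇒cliqueFree (proj₁ feasible 1F)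
    smallFree {2F} c≢2 = ⊥-elim (c≢2 refl)

    module C = Collapse ξ (proj₂ feasible) smallFree
                 (¬monoClique⇒cliqueFree (proj₁ feasible 2F)) a₂≤a₃

  feasible⇒ramseyColouring : RamseyColouring r a₂ a₃
  feasible⇒ramseyColouring = C.ramseyColouring

  feasible-nonconstant⇒ramseyColouring : 3 ≤ a₂ → ∀ {x y} → single ξ x ≢ single ξ y →
    RamseyColouring (suc r) a₂ a₃
  feasible-nonconstant⇒ramseyColouring = C.ramseyColouring-suc

theorem1p8 : ∀ (a₁ a₂ a₃ : ℕ) → 3 ≤ a₁ → a₁ ≤ a₂ → a₂ ≤ a₃ →
    Nice (a₁ ∷ a₂ ∷ a₃ ∷ [])
    × (∀ n → IsRamsey a₂ a₃ n → IsRStar (a₁ ∷ a₂ ∷ a₃ ∷ []) (n ∸ 1))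
theorem1p8 a₁ a₂ a₃ 3≤a₁ a₁≤a₂ a₂≤a₃ = nice , rStar
  where
  2≤a₁ = ℕ.≤-trans (ℕ.n≤1+n 2) 3≤a₁
  3≤a₂ = ℕ.≤-trans 3≤a₁ a₁≤a₂
  1≤a₂ = ℕ.≤-trans (s≤s z≤n) 3≤a₂

  nice : Nice (a₁ ∷ a₂ ∷ a₃ ∷ [])
  nice r (_ , maximal) ξ feasible x y with single ξ x ≟ single ξ y
  ... | yes sx≡sy = sx≡sy
  ... | no sx≢sy  = ⊥-elim (maximal (suc r) (ℕ.n<1+n r) (ramseyColouring⇒hasFeasible 2≤a₁
                      (feasible-nonconstant⇒ramseyColouring a₁≤a₂ a₂≤a₃ ξ feasible 3≤a₂ sx≢sy)))

  rStar : ∀ n → IsRamsey a₂ a₃ n → IsRStar (a₁ ∷ a₂ ∷ a₃ ∷ []) (n ∸ 1)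
  rStar zero    (arrows , _)       = ⊥-elim (¬arrows-0 1≤a₂ (ℕ.≤-trans 1≤a₂ a₂≤a₃) arrows)
  rStar (suc r) (arrows , minimal) =
    ramseyColouring⇒hasFeasible 2≤a₁ (¬arrows⇒ramseyColouring (minimal r (ℕ.n<1+n r))) ,
    λ s r<s (ξ , feasible) →
      ramseyColouring⇒¬arrows
        (ramseyColouring-restrict r<s (feasible⇒ramseyColouring a₁≤a₂ a₂≤a₃ ξ feasible)) arrows
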